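{- If $G$ is a regular hypo-efficient domination graph having a $\gamma$-critical vertex, then $|V(G)|=(\Delta(G)+1)(\gamma(G)-1)+1=(\delta(G)+1)(\gamma(G)-1)+1$.
   Context: All graphs are finite, simple and undirected; $\delta(G)$ and $\Delta(G)$ are the minimum and maximum degree. A dominating set of $G$ is a set $D\subseteq V(G)$ such that every vertex not in $D$ has a neighbor in $D$; $\gamma(G)$ is the minimum size of a dominating set. A vertex $v$ is $\gamma$-critical if $\gamma(G-v)<\gamma(G)$. An efficient dominating set (EDS) of $G$ is a set $D\subseteq V(G)$ with $|N[v]\cap D|=1$ for every $v\in V(G)$, where $N[v]$ is the closed neighborhood of $v$. A graph $G$ is a hypo-efficient domination graph if $G$ has no EDS but $G-v$ has at least one EDS for every $v\in V(G)$. -}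

module Defs where

open import Data.Nat using (ℕ; zero; suc; _≤_; _<_; _⊔_; _⊓_)
open import Data.Bool using (Bool; true; false; T; _∨_)
open import Data.Fin using (Fin; punchIn; _≟_)
open import Relation.Nullary.Decidable using (⌊_⌋)
open import Data.Fin.Subset using (Subset; ∣_∣; _∈_; _∉_; _∩_)
open import Data.Vec using (tabulate)
open import Data.List using (List; foldr; allFin)
open import Data.Product using (Σ; _×_; ∃)
open import Relation.Binary.PropositionalEquality using (_≡_)
open import Relation.Nullary using (¬_)

record Graph (n : ℕ) : Set where
  field
    adj   : Fin n → Fin n → Bool
    sym   : ∀ u v → adj u v ≡ adj v u
    irrfl : ∀ v → adj v v ≡ false
open Graph public

Adj : ∀ {n} → Graph n → Fin n → Fin n → Set
Adj G u v = T (adj G u v)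

deleteV : ∀ {n} → Graph (suc n) → Fin (suc n) → Graph n
deleteV G v = record
  { adj   = λ a b → adj G (punchIn v a) (punchIn v b)
  ; sym   = λ a b → sym G (punchIn v a) (punchIn v b)
  ; irrfl = λ a → irrfl G (punchIn v a)
  }

nbhd : ∀ {n} → Graph n → Fin n → Subset n
nbhd G v = tabulate (adj G v)

deg : ∀ {n} → Graph n → Fin n → ℕ
deg G v = ∣ nbhd G v ∣

-- Maximum degree Δ(G) (0 for the empty graph)
maxDeg : ∀ {n} → Graph n → ℕ
maxDeg {n} G = foldr (λ v m → deg G v ⊔ m) 0 (allFin n)

-- Minimum degree δ(G) (equals n for the empty graph n = 0, an irrelevant convention)
minDeg : ∀ {n} → Graph n → ℕ
minDeg {n} G = foldr (λ v m → deg G v ⊓ m) n (allFin n)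

Regular : ∀ {n} → Graph n → Set
Regular G = ∀ u v → deg G u ≡ deg G v

closedNbhd : ∀ {n} → Graph n → Fin n → Subset n
closedNbhd G v = tabulate (λ u → adj G v u ∨ ⌊ u ≟ v ⌋)

Dominating : ∀ {n} → Graph n → Subset n → Set
Dominating {n} G D = ∀ v → v ∉ D → Σ (Fin n) (λ u → u ∈ D × Adj G u v)

IsDomNumber : ∀ {n} → Graph n → ℕ → Set
IsDomNumber G g =
  Σ (Subset _) (λ D → Dominating G D × ∣ D ∣ ≡ g)
  × (∀ D → Dominating G D → g ≤ ∣ D ∣)

GammaCritical : ∀ {n} → Graph (suc n) → Fin (suc n) → Set
GammaCritical G v =
  ∀ g g′ → IsDomNumber G g → IsDomNumber (deleteV G v) g′ → g′ < g

EfficientDominating : ∀ {n} → Graph n → Subset n → Set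
EfficientDominating G D = ∀ v → ∣ closedNbhd G v ∩ D ∣ ≡ 1

HasEDS : ∀ {n} → Graph n → Set
HasEDS G = Σ (Subset _) (λ D → EfficientDominating G D)

HypoEfficient : ∀ {n} → Graph n → Set
HypoEfficient {zero}  G = ¬ HasEDS G
HypoEfficient {suc n} G = ¬ HasEDS G × (∀ v → HasEDS (deleteV G v))

module Submission where

-- Let v be a γ-critical vertex and D an efficient dominating set of G − v.
-- The closed neighbourhoods of the vertices of D partition the vertex set of
-- G − v and every dominating set meets each of them, so D is a minimum
-- dominating set: γ(G − v) = |D| < γ(G).  Adding v to D dominates G, hence
-- γ(G) = |D| + 1; and no vertex of D can be adjacent to v, since then D
-- alone would dominate G.  So in G − v the vertices of D keep their
-- G-degree k = Δ(G) = δ(G), and the partition gives |V(G)| − 1 = |D| (k + 1).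

open import Defs hiding (sym)
open import Data.Nat using (ℕ; suc; _+_; _*_; _∸_)
open import Data.Fin using (Fin)
open import Data.Product using (Σ; _×_)
open import Relation.Binary.PropositionalEquality using (_≡_)

open import Data.Nat using (zero; _≤_; _<_; _⊔_; _⊓_; z≤n)
open import Data.Nat.Properties hiding (_≟_)
open import Data.Nat.Tactic.RingSolver using (solve-∀)
open import Algebra.Properties.Semiring.Sum +-*-semiring
  using (sum; sum-syntax; sum-cong-≗; sum-remove; ∑-comm; *-distribˡ-sum; *-distribʳ-sum)
open import Data.Bool using (Bool; true; false; T; _∧_; _∨_)
open import Data.Bool.Properties using (T-≡; T-∧; T-∨; ∨-identityʳ)
open import Data.Fin using (zero; suc; punchIn; punchOut; _≟_)
open import Data.Fin.Properties using (punchInᵢ≢i; punchIn-punchOut)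
open import Data.Fin.Subset using (Subset; ∣_∣; _∈_; _∉_; _∩_)
open import Data.Fin.Subset.Properties using (_∈?_; ∣p∣≤n)
open import Data.Vec using ([]; _∷_; lookup; tabulate; insertAt)
open import Data.Vec.Properties
  using ([]=⇒lookup; lookup⇒[]=; lookup-zipWith; lookup∘tabulate; insertAt-lookup; insertAt-punchIn)
open import Data.List using (foldr)
import Data.List as List
open import Data.Product using (∃; _,_; proj₁; proj₂)
open import Data.Sum using (inj₁; inj₂; [_,_])
open import Data.Unit using (tt)
open import Function using (_∘_; id)
open import Function.Bundles using (Equivalence)
open import Relation.Nullary using (¬_; yes; no; contradiction)
open import Relation.Nullary.Decidable using (⌊_⌋; toWitness; fromWitness)
open import Relation.Binary.PropositionalEquality using (_≢_; refl; sym; trans; cong; cong₂; subst; module ≡-Reasoning)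

open Equivalence using (to; from)

⟦_⟧ : Bool → ℕ
⟦ true ⟧  = 1
⟦ false ⟧ = 0

⟦∧⟧ : ∀ a b → ⟦ a ∧ b ⟧ ≡ ⟦ a ⟧ * ⟦ b ⟧
⟦∧⟧ true  b = sym (+-identityʳ ⟦ b ⟧)
⟦∧⟧ false b = refl

⟦⟧-T : ∀ {b} → T b → ⟦ b ⟧ ≡ 1
⟦⟧-T {true} _ = refl

⟦⟧-¬T : ∀ {b} → ¬ T b → ⟦ b ⟧ ≡ 0
⟦⟧-¬T {true}  ¬t = contradiction tt ¬t
⟦⟧-¬T {false} _  = refl

∑-mono-≤ : ∀ {n} {f g : Fin n → ℕ} → (∀ i → f i ≤ g i) → sum f ≤ sum g
∑-mono-≤ {zero}  f≤g = z≤n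
∑-mono-≤ {suc n} f≤g = +-mono-≤ (f≤g zero) (∑-mono-≤ (f≤g ∘ suc))

≤-∑ : ∀ {n} (f : Fin n → ℕ) i → f i ≤ sum f
≤-∑ {suc n} f i = ≤-trans (m≤m+n (f i) _) (≤-reflexive (sym (sum-remove {i = i} f)))

∑-1≡n : ∀ n → ∑[ i < n ] 1 ≡ n
∑-1≡n zero    = refl
∑-1≡n (suc n) = cong suc (∑-1≡n n)

∑⟦⟧-pos⇒∃ : ∀ {n} (f : Fin n → Bool) → 0 < ∑[ i < n ] ⟦ f i ⟧ → ∃ λ i → T (f i)
∑⟦⟧-pos⇒∃ {suc n} f pos with f zero in f₀
... | true  = zero , subst T (sym f₀) tt
... | false = let i , fi = ∑⟦⟧-pos⇒∃ (f ∘ suc) pos in suc i , fi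

∣p∣≡∑ : ∀ {n} (p : Subset n) → ∣ p ∣ ≡ ∑[ i < n ] ⟦ lookup p i ⟧
∣p∣≡∑ []          = refl
∣p∣≡∑ (true ∷ p)  = cong suc (∣p∣≡∑ p)
∣p∣≡∑ (false ∷ p) = ∣p∣≡∑ p

∣tabulate∣≡∑ : ∀ {n} (f : Fin n → Bool) → ∣ tabulate f ∣ ≡ ∑[ i < n ] ⟦ f i ⟧
∣tabulate∣≡∑ f = trans (∣p∣≡∑ (tabulate f)) (sum-cong-≗ (cong ⟦_⟧ ∘ lookup∘tabulate f))

∣tabulate∩p∣≡∑ : ∀ {n} (f : Fin n → Bool) (p : Subset n) →
                 ∣ tabulate f ∩ p ∣ ≡ ∑[ i < n ] ⟦ f i ∧ lookup p i ⟧
∣tabulate∩p∣≡∑ f p = trans (∣p∣≡∑ (tabulate f ∩ p)) (sum-cong-≗ λ i → cong ⟦_⟧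
  (trans (lookup-zipWith _∧_ i (tabulate f) p) (cong (_∧ lookup p i) (lookup∘tabulate f i))))

T-lookup⇒∈ : ∀ {n} {x : Fin n} {p : Subset n} → T (lookup p x) → x ∈ p
T-lookup⇒∈ {x = x} {p} t = lookup⇒[]= x p (to T-≡ t)

∣insertAt∣ : ∀ {n} (p : Subset n) v b → ∣ insertAt p v b ∣ ≡ ⟦ b ⟧ + ∣ p ∣
∣insertAt∣ {n} p v b = begin
  ∣ insertAt p v b ∣
    ≡⟨ ∣p∣≡∑ (insertAt p v b) ⟩
  ∑[ x < suc n ] ⟦ lookup (insertAt p v b) x ⟧
    ≡⟨ sum-remove {i = v} (λ x → ⟦ lookup (insertAt p v b) x ⟧) ⟩
  ⟦ lookup (insertAt p v b) v ⟧ + ∑[ a < n ] ⟦ lookup (insertAt p v b) (punchIn v a) ⟧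
    ≡⟨ cong₂ _+_ (cong ⟦_⟧ (insertAt-lookup p v b)) (sum-cong-≗ (cong ⟦_⟧ ∘ insertAt-punchIn p v b)) ⟩
  ⟦ b ⟧ + ∑[ a < n ] ⟦ lookup p a ⟧
    ≡⟨ cong (⟦ b ⟧ +_) (∣p∣≡∑ p) ⟨
  ⟦ b ⟧ + ∣ p ∣
    ∎
  where open ≡-Reasoning

∈-insertAt-punchIn : ∀ {n} {p : Subset n} {v b u} → u ∈ p → punchIn v u ∈ insertAt p v b
∈-insertAt-punchIn {p = p} {v} {b} {u} u∈p =
  lookup⇒[]= (punchIn v u) _ (trans (insertAt-punchIn p v b u) ([]=⇒lookup u∈p))

Adj-sym : ∀ {n} (G : Graph n) {u v} → Adj G u v → Adj G v u
Adj-sym G {u} {v} = subst T (Graph.sym G u v)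

closedAdj : ∀ {n} → Graph n → Fin n → Fin n → Bool
closedAdj G v u = adj G v u ∨ ⌊ u ≟ v ⌋

closedAdj-refl : ∀ {n} (G : Graph n) v → T (closedAdj G v v)
closedAdj-refl G v = from (T-∨ {adj G v v}) (inj₂ (fromWitness refl))

Adj⇒closedAdj : ∀ {n} (G : Graph n) {u v} → Adj G u v → T (closedAdj G u v)
Adj⇒closedAdj G {u} a = from (T-∨ {adj G u _}) (inj₁ a)

closedAdj⇒Adj : ∀ {n} (G : Graph n) {u v} → T (closedAdj G u v) → v ≢ u → Adj G u v
closedAdj⇒Adj G {u} {v} c v≢u =
  [ id , (λ v≡u → contradiction (toWitness v≡u) v≢u) ] (to (T-∨ {adj G u v}) c)

∑closedAdj≡suc-deg : ∀ {n} (G : Graph n) y → ∑[ x < n ] ⟦ closedAdj G x y ⟧ ≡ suc (deg G y)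
∑closedAdj≡suc-deg {suc n} G y = begin
  ∑[ x < suc n ] ⟦ closedAdj G x y ⟧
    ≡⟨ sum-remove {i = y} (λ x → ⟦ closedAdj G x y ⟧) ⟩
  ⟦ closedAdj G y y ⟧ + ∑[ a < n ] ⟦ closedAdj G (punchIn y a) y ⟧
    ≡⟨ cong₂ _+_ (⟦⟧-T (closedAdj-refl G y)) (sum-cong-≗ off-diagonal) ⟩
  suc (∑[ a < n ] ⟦ adj G y (punchIn y a) ⟧)
    ≡⟨ cong (λ b → suc (⟦ b ⟧ + ∑[ a < n ] ⟦ adj G y (punchIn y a) ⟧)) (irrfl G y) ⟨
  suc (⟦ adj G y y ⟧ + ∑[ a < n ] ⟦ adj G y (punchIn y a) ⟧)
    ≡⟨ cong suc (sum-remove {i = y} (λ x → ⟦ adj G y x ⟧)) ⟨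
  suc (∑[ x < suc n ] ⟦ adj G y x ⟧)
    ≡⟨ cong suc (∣tabulate∣≡∑ (adj G y)) ⟨
  suc (deg G y)
    ∎
  where
  open ≡-Reasoning
  off-diagonal : ∀ a → ⟦ closedAdj G (punchIn y a) y ⟧ ≡ ⟦ adj G y (punchIn y a) ⟧
  off-diagonal a with y ≟ punchIn y a
  ... | yes y≡a⁺ = contradiction (sym y≡a⁺) (punchInᵢ≢i y a)
  ... | no  _    = cong ⟦_⟧ (trans (cong (_∨ false) (Graph.sym G (punchIn y a) y)) (∨-identityʳ _))

Dominated : ∀ {n} → Graph n → Subset n → Fin n → Set
Dominated {n} G S x = Σ (Fin n) λ u → u ∈ S × Adj G u x

dominating⇒meets-closedNbhd : ∀ {n} (G : Graph n) {S} → Dominating G S →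
                              ∀ y → ∃ λ x → x ∈ S × T (closedAdj G x y)
dominating⇒meets-closedNbhd G {S} dom y with y ∈? S
... | yes y∈S = y , y∈S , closedAdj-refl G y
... | no  y∉S = let u , u∈S , u~y = dom y y∉S in u , u∈S , Adj⇒closedAdj G u~y

-- Each x lies in exactly one N[y] with y ∈ D, so a sum over the vertices
-- regroups as a sum over the closed neighbourhoods of D.
efficient⇒∑-by-closedNbhds : ∀ {n} (G : Graph n) D → EfficientDominating G D → (w : Fin n → ℕ) →
  ∑[ x < n ] w x ≡ ∑[ y < n ] (⟦ lookup D y ⟧ * ∑[ x < n ] (⟦ closedAdj G x y ⟧ * w x))
efficient⇒∑-by-closedNbhds {n} G D efficient w = begin
  ∑[ x < n ] w x
    ≡⟨ sum-cong-≗ covered-once ⟨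
  ∑[ x < n ] (∑[ y < n ] ⟦ c x y ∧ d y ⟧ * w x)
    ≡⟨ sum-cong-≗ (λ x → *-distribʳ-sum (w x) (λ y → ⟦ c x y ∧ d y ⟧)) ⟩
  ∑[ x < n ] ∑[ y < n ] (⟦ c x y ∧ d y ⟧ * w x)
    ≡⟨ ∑-comm (λ x y → ⟦ c x y ∧ d y ⟧ * w x) ⟩
  ∑[ y < n ] ∑[ x < n ] (⟦ c x y ∧ d y ⟧ * w x)
    ≡⟨ sum-cong-≗ factor-d ⟩
  ∑[ y < n ] (⟦ d y ⟧ * ∑[ x < n ] (⟦ c x y ⟧ * w x))
    ∎
  where
  open ≡-Reasoning
  c = closedAdj G
  d = lookup D
  covered-once : ∀ x → ∑[ y < n ] ⟦ c x y ∧ d y ⟧ * w x ≡ w x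
  covered-once x =
    trans (cong (_* w x) (trans (sym (∣tabulate∩p∣≡∑ (c x) D)) (efficient x))) (*-identityˡ (w x))
  reassoc : ∀ y x → ⟦ c x y ∧ d y ⟧ * w x ≡ ⟦ d y ⟧ * (⟦ c x y ⟧ * w x)
  reassoc y x = begin
    ⟦ c x y ∧ d y ⟧ * w x
      ≡⟨ cong (_* w x) (trans (⟦∧⟧ (c x y) (d y)) (*-comm ⟦ c x y ⟧ ⟦ d y ⟧)) ⟩
    ⟦ d y ⟧ * ⟦ c x y ⟧ * w x
      ≡⟨ *-assoc ⟦ d y ⟧ ⟦ c x y ⟧ (w x) ⟩
    ⟦ d y ⟧ * (⟦ c x y ⟧ * w x)
      ∎
  factor-d : ∀ y → ∑[ x < n ] (⟦ c x y ∧ d y ⟧ * w x) ≡ ⟦ d y ⟧ * ∑[ x < n ] (⟦ c x y ⟧ * w x)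
  factor-d y = trans (sum-cong-≗ (reassoc y)) (sym (*-distribˡ-sum ⟦ d y ⟧ (λ x → ⟦ c x y ⟧ * w x)))

efficient⇒dominating : ∀ {n} (G : Graph n) D → EfficientDominating G D → Dominating G D
efficient⇒dominating {n} G D efficient x x∉D = y , y∈D , Adj-sym G (closedAdj⇒Adj G x~y y≢x)
  where
  meets : 0 < ∑[ y < n ] ⟦ closedAdj G x y ∧ lookup D y ⟧
  meets = ≤-reflexive (sym (trans (sym (∣tabulate∩p∣≡∑ (closedAdj G x) D)) (efficient x)))
  hit : ∃ λ y → T (closedAdj G x y ∧ lookup D y)
  hit = ∑⟦⟧-pos⇒∃ (λ y → closedAdj G x y ∧ lookup D y) meets
  y = proj₁ hit
  x~y = proj₁ (to T-∧ (proj₂ hit))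
  y∈D = T-lookup⇒∈ (proj₂ (to T-∧ (proj₂ hit)))
  y≢x : y ≢ x
  y≢x y≡x = x∉D (subst (_∈ D) y≡x y∈D)

efficient⇒minimum : ∀ {n} (G : Graph n) D → EfficientDominating G D →
                    ∀ S → Dominating G S → ∣ D ∣ ≤ ∣ S ∣
efficient⇒minimum {n} G D efficient S dom = begin
  ∣ D ∣
    ≡⟨ ∣p∣≡∑ D ⟩
  ∑[ y < n ] ⟦ lookup D y ⟧
    ≡⟨ sum-cong-≗ (λ y → *-identityʳ ⟦ lookup D y ⟧) ⟨
  ∑[ y < n ] (⟦ lookup D y ⟧ * 1)
    ≤⟨ ∑-mono-≤ (λ y → *-monoʳ-≤ ⟦ lookup D y ⟧ (meets y)) ⟩
  ∑[ y < n ] (⟦ lookup D y ⟧ * ∑[ x < n ] (⟦ closedAdj G x y ⟧ * ⟦ lookup S x ⟧))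
    ≡⟨ efficient⇒∑-by-closedNbhds G D efficient (λ x → ⟦ lookup S x ⟧) ⟨
  ∑[ x < n ] ⟦ lookup S x ⟧
    ≡⟨ ∣p∣≡∑ S ⟨
  ∣ S ∣
    ∎
  where
  open ≤-Reasoning
  meets : ∀ y → 1 ≤ ∑[ x < n ] (⟦ closedAdj G x y ⟧ * ⟦ lookup S x ⟧)
  meets y with dominating⇒meets-closedNbhd G dom y
  ... | x , x∈S , x~y = ≤-trans
    (≤-reflexive (sym (cong₂ _*_ (⟦⟧-T x~y) (cong ⟦_⟧ ([]=⇒lookup x∈S)))))
    (≤-∑ (λ x → ⟦ closedAdj G x y ⟧ * ⟦ lookup S x ⟧) x)

efficient⇒isDomNumber : ∀ {n} (G : Graph n) D → EfficientDominating G D → IsDomNumber G ∣ D ∣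
efficient⇒isDomNumber G D efficient =
  (D , efficient⇒dominating G D efficient , refl) , efficient⇒minimum G D efficient

efficient⇒n≡∣D∣*suc-k : ∀ {n} (G : Graph n) D → EfficientDominating G D →
                        ∀ {k} → (∀ y → y ∈ D → deg G y ≡ k) → n ≡ ∣ D ∣ * suc k
efficient⇒n≡∣D∣*suc-k {n} G D efficient {k} deg≡k = begin
  n
    ≡⟨ ∑-1≡n n ⟨
  ∑[ x < n ] 1
    ≡⟨ efficient⇒∑-by-closedNbhds G D efficient (λ _ → 1) ⟩
  ∑[ y < n ] (⟦ lookup D y ⟧ * ∑[ x < n ] (⟦ closedAdj G x y ⟧ * 1))
    ≡⟨ sum-cong-≗ closedNbhd-size ⟩
  ∑[ y < n ] (⟦ lookup D y ⟧ * suc k)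
    ≡⟨ *-distribʳ-sum (suc k) (λ y → ⟦ lookup D y ⟧) ⟨
  ∑[ y < n ] ⟦ lookup D y ⟧ * suc k
    ≡⟨ cong (_* suc k) (∣p∣≡∑ D) ⟨
  ∣ D ∣ * suc k
    ∎
  where
  open ≡-Reasoning
  closedNbhd-size : ∀ y →
    ⟦ lookup D y ⟧ * ∑[ x < n ] (⟦ closedAdj G x y ⟧ * 1) ≡ ⟦ lookup D y ⟧ * suc k
  closedNbhd-size y with lookup D y in y∈D
  ... | false = refl
  ... | true  = cong (1 *_) (begin
    ∑[ x < n ] (⟦ closedAdj G x y ⟧ * 1) ≡⟨ sum-cong-≗ (λ x → *-identityʳ ⟦ closedAdj G x y ⟧) ⟩
    ∑[ x < n ] ⟦ closedAdj G x y ⟧       ≡⟨ ∑closedAdj≡suc-deg G y ⟩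
    suc (deg G y)                        ≡⟨ cong suc (deg≡k y (lookup⇒[]= y D y∈D)) ⟩
    suc k                                ∎)

deg-deleteV : ∀ {n} (G : Graph (suc n)) v u → ¬ Adj G (punchIn v u) v →
              deg (deleteV G v) u ≡ deg G (punchIn v u)
deg-deleteV {n} G v u u≁v = begin
  deg (deleteV G v) u
    ≡⟨ ∣tabulate∣≡∑ (λ a → adj G w (punchIn v a)) ⟩
  ∑[ a < n ] ⟦ adj G w (punchIn v a) ⟧
    ≡⟨ cong (_+ ∑[ a < n ] ⟦ adj G w (punchIn v a) ⟧) (⟦⟧-¬T u≁v) ⟨
  ⟦ adj G w v ⟧ + ∑[ a < n ] ⟦ adj G w (punchIn v a) ⟧
    ≡⟨ sum-remove {i = v} (λ x → ⟦ adj G w x ⟧) ⟨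
  ∑[ x < suc n ] ⟦ adj G w x ⟧
    ≡⟨ ∣tabulate∣≡∑ (adj G w) ⟨
  deg G w
    ∎
  where
  open ≡-Reasoning
  w = punchIn v u

dominating-insertAt : ∀ {n} (G : Graph (suc n)) v {D b} → Dominating (deleteV G v) D →
                      (v ∉ insertAt D v b → Dominated G (insertAt D v b) v) →
                      Dominating G (insertAt D v b)
dominating-insertAt G v {D} {b} dom dom-v x x∉ with v ≟ x
... | yes refl = dom-v x∉
... | no  v≢x  = subst (λ x → x ∉ insertAt D v b → Dominated G (insertAt D v b) x)
                       (punchIn-punchOut v≢x) (dominated-punchIn (punchOut v≢x)) x∉
  where
  dominated-punchIn : ∀ a → punchIn v a ∉ insertAt D v b → Dominated G (insertAt D v b) (punchIn v a)
  dominated-punchIn a a∉ =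
    let u , u∈D , u~a = dom a (a∉ ∘ ∈-insertAt-punchIn) in punchIn v u , ∈-insertAt-punchIn u∈D , u~a

module _ {n} (G : Graph (suc n)) (v : Fin (suc n)) {g} (γ≡g : IsDomNumber G g) (critical : GammaCritical G v)
         {D} (efficient : EfficientDominating (deleteV G v) D) where

  private
    ∣D∣<g : ∣ D ∣ < g
    ∣D∣<g = critical g ∣ D ∣ γ≡g (efficient⇒isDomNumber (deleteV G v) D efficient)

    g≤∣insertAt∣ : ∀ {b} → (v ∉ insertAt D v b → Dominated G (insertAt D v b) v) → g ≤ ⟦ b ⟧ + ∣ D ∣
    g≤∣insertAt∣ {b} dom-v = ≤-trans
      (proj₂ γ≡g _ (dominating-insertAt G v (efficient⇒dominating (deleteV G v) D efficient) dom-v))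
      (≤-reflexive (∣insertAt∣ D v b))

  critical⇒γ≡suc∣D∣ : g ≡ suc ∣ D ∣
  critical⇒γ≡suc∣D∣ = ≤-antisym
    (g≤∣insertAt∣ (contradiction (lookup⇒[]= v _ (insertAt-lookup D v true))))
    ∣D∣<g

  critical⇒D≁v : ∀ {u} → u ∈ D → ¬ Adj G (punchIn v u) v
  critical⇒D≁v {u} u∈D u~v =
    <⇒≱ ∣D∣<g (g≤∣insertAt∣ {false} (λ _ → punchIn v u , ∈-insertAt-punchIn u∈D , u~v))

foldr-⊔-const : ∀ {a} {A : Set a} (f : A → ℕ) {k} → (∀ x → f x ≡ k) →
                ∀ x xs → foldr (λ y m → f y ⊔ m) 0 (x List.∷ xs) ≡ k
foldr-⊔-const f f≡k x List.[]         = trans (⊔-identityʳ (f x)) (f≡k x)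
foldr-⊔-const f f≡k x (y List.∷ ys) = trans (cong₂ _⊔_ (f≡k x) (foldr-⊔-const f f≡k y ys)) (⊔-idem _)

foldr-⊓-const : ∀ {a} {A : Set a} (f : A → ℕ) {k c} → k ≤ c → (∀ x → f x ≡ k) →
                ∀ x xs → foldr (λ y m → f y ⊓ m) c (x List.∷ xs) ≡ k
foldr-⊓-const f k≤c f≡k x List.[]         = trans (cong (_⊓ _) (f≡k x)) (m≤n⇒m⊓n≡m k≤c)
foldr-⊓-const f k≤c f≡k x (y List.∷ ys) = trans (cong₂ _⊓_ (f≡k x) (foldr-⊓-const f k≤c f≡k y ys)) (⊓-idem _)

regular⇒maxDeg≡deg : ∀ {n} (G : Graph (suc n)) → Regular G → ∀ v → maxDeg G ≡ deg G v
regular⇒maxDeg≡deg G regular v = foldr-⊔-const (deg G) (λ u → regular u v) zero (List.tabulate suc)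

regular⇒minDeg≡deg : ∀ {n} (G : Graph (suc n)) → Regular G → ∀ v → minDeg G ≡ deg G v
regular⇒minDeg≡deg G regular v =
  foldr-⊓-const (deg G) (∣p∣≤n (nbhd G v)) (λ u → regular u v) zero (List.tabulate suc)

size-identity : ∀ m k → suc (m * suc k) ≡ (k + 1) * m + 1
size-identity = solve-∀

corollary3p17 : (n : ℕ) (G : Graph (suc n)) → Regular G → HypoEfficient G
    → Σ (Fin (suc n)) (λ v → GammaCritical G v)
    → (g : ℕ) → IsDomNumber G g
    → (suc n ≡ (maxDeg G + 1) * (g ∸ 1) + 1) × (suc n ≡ (minDeg G + 1) * (g ∸ 1) + 1)
corollary3p17 n G regular (_ , deleted-efficient) (v , critical) g γ≡g =
  count (regular⇒maxDeg≡deg G regular v) , count (regular⇒minDeg≡deg G regular v)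
  where
  D = proj₁ (deleted-efficient v)
  efficient = proj₂ (deleted-efficient v)
  k = deg G v
  deg≡k : ∀ y → y ∈ D → deg (deleteV G v) y ≡ k
  deg≡k y y∈D = trans (deg-deleteV G v y (critical⇒D≁v G v γ≡g critical efficient y∈D)) (regular _ v)
  count : ∀ {t} → t ≡ k → suc n ≡ (t + 1) * (g ∸ 1) + 1
  count refl = begin
    suc n
      ≡⟨ cong suc (efficient⇒n≡∣D∣*suc-k (deleteV G v) D efficient deg≡k) ⟩
    suc (∣ D ∣ * suc k)
      ≡⟨ size-identity ∣ D ∣ k ⟩
    (k + 1) * (suc ∣ D ∣ ∸ 1) + 1
      ≡⟨ cong (λ g → (k + 1) * (g ∸ 1) + 1) (critical⇒γ≡suc∣D∣ G v γ≡g critical efficient) ⟨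
    (k + 1) * (g ∸ 1) + 1
      ∎
    where open ≡-Reasoning
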